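{- Define $\mathbf{c}=(c_0,c_1,\ldots)$ by $c_0=1$ and $c_{n+1}=c_n+1$ if $(c_n+1)/2$ is not a term of $\mathbf{c}$, $c_{n+1}=c_n+2$ otherwise. For $n\ge 0$ let $H_n$ be the number of hex trees with $n$ edges. Then $H_n$ is even if and only if $n=4c_k-2$ or $n=4c_k-1$ for some $k\in\mathbb{N}$.
   Context: A ternary tree here is a rooted tree in which each vertex has some subset (possibly empty, possibly proper) of three possible children: a left child, a middle child, and a right child. A hex tree is a ternary tree in which no vertex has two adjacent children, where a middle child is adjacent to a left child and to a right child, but a left and a right child are not adjacent; thus each vertex's set of children is one of $\emptyset$, $\{L\}$, $\{M\}$, $\{R\}$, $\{L,R\}$. -}

module Defs where

open import Data.Nat using (ℕ; zero; suc; _+_; _*_)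
open import Data.Product using (∃-syntax; _×_)
open import Relation.Binary.PropositionalEquality using (_≡_)
open import Relation.Nullary using (¬_)

-- Hex trees indexed by their number of edges.
-- Each vertex has children set ∅, {L}, {M}, {R} or {L,R}.
data HexTree : ℕ → Set where
  leaf : HexTree 0
  onlyL : ∀ {n} → HexTree n → HexTree (suc n)
  onlyM : ∀ {n} → HexTree n → HexTree (suc n)
  onlyR : ∀ {n} → HexTree n → HexTree (suc n)
  both  : ∀ {m n} → HexTree m → HexTree n → HexTree (suc (suc (m + n)))

HalfIsTerm : (ℕ → ℕ) → ℕ → Set
HalfIsTerm c n = ∃[ j ] (2 * c j ≡ c n + 1)

IsCSeq : (ℕ → ℕ) → Set
IsCSeq c =
  (c 0 ≡ 1) × ((∀ n → ¬ HalfIsTerm c n → c (suc n) ≡ c n + 1)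
             × (∀ n → HalfIsTerm c n → c (suc n) ≡ c n + 2))

module Submission where

-- Decomposing a hex tree at its root gives H(x) = 1 + 3x H(x) + x² H(x)², and modulo 2
-- the square of a series is its value at x², so H(n+2) ≡ H(n+1) + [n even] H(n/2): in the
-- convolution the terms (i, j) and (j, i) cancel in pairs. The same recurrence holds for
-- χ(1 + ⌊n/2⌋), where χ is the indicator of the positive integers of even 2-adic
-- valuation, so H(n) is odd iff χ(1 + ⌊n/2⌋) = 1. Those integers are exactly the terms
-- of c, since c skips y + 1 precisely when y + 1 is twice a term. Hence H(n) is even iff
-- 1 + ⌊n/2⌋ = 2 c(k) for some k, that is, iff n ∈ {4 c(k) − 2, 4 c(k) − 1}.


open import Data.Fin using (Fin)
open import Data.Fin.Permutation using (↔⇒≡)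
open import Data.Fin.Properties using (+↔⊎; *↔×; 1↔⊤)
open import Data.Nat using (ℕ; zero; suc; _+_; _*_; _∸_; _≤_; _<_; z≤n; s≤s; ⌊_/2⌋; parity; NonZero; _≤?_; _<?_)
open import Data.Nat.Divisibility using (_∣_; divides; ∣-refl; ∣m∣n⇒∣m+n)
open import Data.Nat.Induction using (<-rec)
open import Data.Nat.Properties
  using (+-comm; +-suc; +-identityʳ; suc-injective; ≡-irrelevant; ≤-refl; ≤-trans; ≤-pred; <-trans;
         <⇒≱; ≰⇒>; n<1+n; m≤n+m; m<m+n; m≤n⇒m≤1+n; m≤n⇒m<n∨m≡n; ⌊n/2⌋<n; n≡⌊n+n/2⌋)
open import Data.Nat.Tactic.RingSolver using (solve-∀)
open import Data.Parity.Base as ℙ using (Parity; 0ℙ; 1ℙ; _⁻¹)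
import Data.Parity.Properties as ℙₚ
open import Data.Product using (Σ-syntax; ∃-syntax; _×_; _,_; proj₁; proj₂)
open import Data.Product.Algebra using (×-comm)
open import Data.Product.Function.Dependent.Propositional using () renaming (congˡ to Σ-congˡ)
open import Data.Product.Function.NonDependent.Propositional using (_×-↔_)
open import Data.Sum using (_⊎_; inj₁; inj₂)
open import Data.Sum.Function.Propositional using (_⊎-↔_)
open import Data.Unit using (⊤)
open import Function using (_∘_)
open import Function.Bundles using (_↔_; _⇔_; mk↔ₛ′; mk⇔; Equivalence)
open import Function.Properties.Inverse using (↔-refl; ↔-sym; ↔-trans)
open import Function.Related.Propositional using (module EquationalReasoning)
open import Relation.Binary.PropositionalEquality using (_≡_; refl; sym; trans; cong; cong₂; subst; module ≡-Reasoning)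
open import Relation.Nullary using (¬_; yes; no; contradiction)
open import Relation.Nullary.Decidable using (decidable-stable)

open import Defs

private
  variable
    A B : Set
    F G : ℕ → Set
    p q : Parity
    a b n : ℕ

HasParity : Set → Parity → Set
HasParity A p = Σ[ n ∈ ℕ ] (A ↔ Fin n) × parity n ≡ p

HasParity-cong : p ≡ q → HasParity A p → HasParity A q
HasParity-cong refl hp = hp

HasParity-↔ : A ↔ B → HasParity B p → HasParity A p
HasParity-↔ A↔B (n , B↔Fin , par) = n , ↔-trans A↔B B↔Fin , par

HasParity-⊤ : HasParity ⊤ 1ℙ
HasParity-⊤ = 1 , ↔-sym 1↔⊤ , refl

HasParity-⊎ : HasParity A p → HasParity B q → HasParity (A ⊎ B) (p ℙ.+ q)
HasParity-⊎ (m , A↔ , refl) (n , B↔ , refl) =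
  m + n , ↔-trans (A↔ ⊎-↔ B↔) (↔-sym +↔⊎) , ℙₚ.+-homo-+ m n

HasParity-× : HasParity A p → HasParity B q → HasParity (A × B) (p ℙ.* q)
HasParity-× (m , A↔ , refl) (n , B↔ , refl) =
  m * n , ↔-trans (A↔ ×-↔ B↔) (↔-sym *↔×) , ℙₚ.*-homo-* m n

HasParity⇒parity : A ↔ Fin n → HasParity A p → parity n ≡ p
HasParity⇒parity A↔Fin (m , A↔Fin′ , par) =
  trans (cong parity (↔⇒≡ (↔-trans (↔-sym A↔Fin) A↔Fin′))) par

infixl 7 _⋆_

_⋆_ : (ℕ → Set) → (ℕ → Set) → ℕ → Set
(F ⋆ G) n = Σ[ i ∈ ℕ ] Σ[ j ∈ ℕ ] i + j ≡ n × F i × G j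

⋆-zero : (F ⋆ G) 0 ↔ (F 0 × G 0)
⋆-zero = mk↔ₛ′ (λ { (0 , 0 , refl , x , y) → x , y })
               (λ (x , y) → 0 , 0 , refl , x , y)
               (λ _ → refl)
               (λ { (0 , 0 , refl , _ , _) → refl })

⋆-suc : (F ⋆ G) (suc n) ↔ (F 0 × G (suc n) ⊎ ((F ∘ suc) ⋆ G) n)
⋆-suc {F = F} {G = G} {n = n} = mk↔ₛ′ to from to∘from from∘to
  where
  to : (F ⋆ G) (suc n) → F 0 × G (suc n) ⊎ ((F ∘ suc) ⋆ G) n
  to (zero  , j , refl , x , y) = inj₁ (x , y)
  to (suc i , j , refl , x , y) = inj₂ (i , j , refl , x , y)
  from : F 0 × G (suc n) ⊎ ((F ∘ suc) ⋆ G) n → (F ⋆ G) (suc n)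
  from (inj₁ (x , y))               = 0 , suc n , refl , x , y
  from (inj₂ (i , j , refl , x , y)) = suc i , j , refl , x , y
  to∘from : ∀ z → to (from z) ≡ z
  to∘from (inj₁ _)                  = refl
  to∘from (inj₂ (_ , _ , refl , _)) = refl
  from∘to : ∀ z → from (to z) ≡ z
  from∘to (zero  , _ , refl , _) = refl
  from∘to (suc _ , _ , refl , _) = refl

⋆-swap : (F ⋆ G) n → (G ⋆ F) n
⋆-swap (i , j , i+j≡n , x , y) = j , i , trans (+-comm j i) i+j≡n , y , x

⋆-swap-involutive : (z : (F ⋆ G) n) → ⋆-swap (⋆-swap z) ≡ z
⋆-swap-involutive (i , j , _ , x , y) = cong (λ e → i , j , e , x , y) (≡-irrelevant _ _)

⋆-comm : (F ⋆ G) n ↔ (G ⋆ F) n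
⋆-comm = mk↔ₛ′ ⋆-swap ⋆-swap ⋆-swap-involutive ⋆-swap-involutive

⋆-sucʳ : (F ⋆ G) (suc n) ↔ (F (suc n) × G 0 ⊎ (F ⋆ (G ∘ suc)) n)
⋆-sucʳ = ↔-trans ⋆-comm (↔-trans ⋆-suc (×-comm _ _ ⊎-↔ ⋆-comm))

p*q+q*p≡0ℙ : ∀ p q → (p ℙ.* q) ℙ.+ (q ℙ.* p) ≡ 0ℙ
p*q+q*p≡0ℙ p q = trans (cong ((p ℙ.* q) ℙ.+_) (ℙₚ.*-comm q p)) (ℙₚ.p+p≡0ℙ (p ℙ.* q))

-- parity n ⁻¹ ℙ.* x is [n even]·x: the summands (i , j) and (j , i) with i ≢ j cancel
-- modulo 2, leaving only the diagonal one.
⋆-self-parity : (F : ℕ → Set) (f : ℕ → Parity) (n : ℕ) →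
                (∀ i → i ≤ n → HasParity (F i) (f i)) →
                HasParity ((F ⋆ F) n) (parity n ⁻¹ ℙ.* f ⌊ n /2⌋)
⋆-self-parity F f 0 F-parity =
  HasParity-cong (ℙₚ.*-idem (f 0)) (HasParity-↔ ⋆-zero (HasParity-× F₀ F₀))
  where F₀ = F-parity 0 z≤n
⋆-self-parity F f 1 F-parity =
  HasParity-cong (p*q+q*p≡0ℙ (f 0) (f 1))
    (HasParity-↔ (↔-trans ⋆-suc (↔-refl ⊎-↔ ⋆-zero))
      (HasParity-⊎ (HasParity-× F₀ F₁) (HasParity-× F₁ F₀)))
  where
  F₀ = F-parity 0 z≤n
  F₁ = F-parity 1 ≤-refl
⋆-self-parity F f (suc (suc n)) F-parity =
  HasParity-cong mirror-cancel
    (HasParity-↔ (↔-trans ⋆-suc (↔-refl ⊎-↔ ⋆-sucʳ))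
      (HasParity-⊎ (HasParity-× F₀ F₂₊ₙ) (HasParity-⊎ (HasParity-× F₂₊ₙ F₀) inner)))
  where
  F₀   = F-parity 0 z≤n
  F₂₊ₙ = F-parity (2 + n) ≤-refl
  inner = ⋆-self-parity (F ∘ suc) (f ∘ suc) n
            (λ i i≤n → F-parity (suc i) (s≤s (m≤n⇒m≤1+n i≤n)))
  f₀   = f 0
  f₂₊ₙ = f (2 + n)
  diagonal = parity n ⁻¹ ℙ.* f (suc ⌊ n /2⌋)
  mirror-cancel : (f₀ ℙ.* f₂₊ₙ) ℙ.+ ((f₂₊ₙ ℙ.* f₀) ℙ.+ diagonal) ≡ diagonal
  mirror-cancel = trans (sym (ℙₚ.+-assoc (f₀ ℙ.* f₂₊ₙ) (f₂₊ₙ ℙ.* f₀) diagonal))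
                        (cong (ℙ._+ diagonal) (p*q+q*p≡0ℙ f₀ f₂₊ₙ))

HexTree[0]↔⊤ : HexTree 0 ↔ ⊤
HexTree[0]↔⊤ = mk↔ₛ′ (λ _ → _) (λ _ → leaf) (λ _ → refl) (λ { leaf → refl })

HexTree[1]↔ : HexTree 1 ↔ (HexTree 0 ⊎ (HexTree 0 ⊎ HexTree 0))
HexTree[1]↔ = mk↔ₛ′ to from to∘from from∘to
  where
  to : HexTree 1 → HexTree 0 ⊎ (HexTree 0 ⊎ HexTree 0)
  to (onlyL t) = inj₁ t
  to (onlyM t) = inj₂ (inj₁ t)
  to (onlyR t) = inj₂ (inj₂ t)
  from : HexTree 0 ⊎ (HexTree 0 ⊎ HexTree 0) → HexTree 1
  from (inj₁ t)        = onlyL t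
  from (inj₂ (inj₁ t)) = onlyM t
  from (inj₂ (inj₂ t)) = onlyR t
  to∘from : ∀ z → to (from z) ≡ z
  to∘from (inj₁ _)        = refl
  to∘from (inj₂ (inj₁ _)) = refl
  to∘from (inj₂ (inj₂ _)) = refl
  from∘to : ∀ t → from (to t) ≡ t
  from∘to (onlyL _) = refl
  from∘to (onlyM _) = refl
  from∘to (onlyR _) = refl

HexTree[2+n]↔ : HexTree (2 + n) ↔
  ((HexTree (1 + n) ⊎ (HexTree (1 + n) ⊎ HexTree (1 + n))) ⊎ (HexTree ⋆ HexTree) n)
HexTree[2+n]↔ {n} = mk↔ₛ′ to from to∘from from∘to
  where
  Root = (HexTree (1 + n) ⊎ (HexTree (1 + n) ⊎ HexTree (1 + n))) ⊎ (HexTree ⋆ HexTree) n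
  to : HexTree (2 + n) → Root
  to (onlyL t)           = inj₁ (inj₁ t)
  to (onlyM t)           = inj₁ (inj₂ (inj₁ t))
  to (onlyR t)           = inj₁ (inj₂ (inj₂ t))
  to (both {i} {j} t u)  = inj₂ (i , j , refl , t , u)
  from : Root → HexTree (2 + n)
  from (inj₁ (inj₁ t))               = onlyL t
  from (inj₁ (inj₂ (inj₁ t)))        = onlyM t
  from (inj₁ (inj₂ (inj₂ t)))        = onlyR t
  from (inj₂ (_ , _ , refl , t , u)) = both t u
  to∘from : ∀ z → to (from z) ≡ z
  to∘from (inj₁ (inj₁ _))          = refl
  to∘from (inj₁ (inj₂ (inj₁ _)))   = refl
  to∘from (inj₁ (inj₂ (inj₂ _)))   = refl
  to∘from (inj₂ (_ , _ , refl , _)) = refl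
  from∘to : ∀ t → from (to t) ≡ t
  from∘to (onlyL _)  = refl
  from∘to (onlyM _)  = refl
  from∘to (onlyR _)  = refl
  from∘to (both _ _) = refl

HexTree-parity : (f : ℕ → Parity) → f 0 ≡ 1ℙ → f 1 ≡ 1ℙ →
                 (∀ n → f (2 + n) ≡ f (1 + n) ℙ.+ (parity n ⁻¹ ℙ.* f ⌊ n /2⌋)) →
                 ∀ n → HasParity (HexTree n) (f n)
HexTree-parity f f₀ f₁ f-rec = <-rec _ step
  where
  single : HasParity (HexTree 0) 1ℙ
  single = HasParity-↔ HexTree[0]↔⊤ HasParity-⊤
  triple : ∀ p → p ℙ.+ (p ℙ.+ p) ≡ p
  triple p = trans (cong (p ℙ.+_) (ℙₚ.p+p≡0ℙ p)) (ℙₚ.+-identityʳ p)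
  step : ∀ n → (∀ {m} → m < n → HasParity (HexTree m) (f m)) → HasParity (HexTree n) (f n)
  step 0 _ = HasParity-cong (sym f₀) single
  step 1 _ = HasParity-cong (sym f₁)
    (HasParity-↔ HexTree[1]↔ (HasParity-⊎ single (HasParity-⊎ single single)))
  step (suc (suc n)) ih =
    HasParity-cong (trans (cong (ℙ._+ diagonal) (triple (f (1 + n)))) (sym (f-rec n)))
      (HasParity-↔ HexTree[2+n]↔
        (HasParity-⊎ (HasParity-⊎ T₁₊ₙ (HasParity-⊎ T₁₊ₙ T₁₊ₙ))
                     (⋆-self-parity HexTree f n (λ i i≤n → ih (s≤s (m≤n⇒m≤1+n i≤n))))))
    where
    T₁₊ₙ = ih (n<1+n (suc n))
    diagonal = parity n ⁻¹ ℙ.* f ⌊ n /2⌋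

data EvenOrOdd : ℕ → Set where
  even : ∀ k → EvenOrOdd (k + k)
  odd  : ∀ k → EvenOrOdd (suc (k + k))

evenOrOdd : ∀ n → EvenOrOdd n
evenOrOdd zero = even 0
evenOrOdd (suc n) with evenOrOdd n
... | even k = odd k
... | odd k  = subst EvenOrOdd (cong suc (+-suc k k)) (even (suc k))

n≡⌊1+n+n/2⌋ : ∀ n → n ≡ ⌊ suc (n + n) /2⌋
n≡⌊1+n+n/2⌋ zero    = refl
n≡⌊1+n+n/2⌋ (suc n) = cong suc (trans (n≡⌊1+n+n/2⌋ n) (cong ⌊_/2⌋ (sym (+-suc n n))))

parity[n+n]≡0ℙ : ∀ n → parity (n + n) ≡ 0ℙ
parity[n+n]≡0ℙ n = trans (ℙₚ.+-homo-+ n n) (ℙₚ.p+p≡0ℙ (parity n))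

parity[1+n+n]≡1ℙ : ∀ n → parity (suc (n + n)) ≡ 1ℙ
parity[1+n+n]≡1ℙ n = trans (ℙₚ.+-homo-+ 1 (n + n)) (cong (1ℙ ℙ.+_) (parity[n+n]≡0ℙ n))

⌊n/2⌋≡m⇔ : ∀ n m → ⌊ n /2⌋ ≡ m ⇔ (n ≡ m + m ⊎ n ≡ suc (m + m))
⌊n/2⌋≡m⇔ n m = mk⇔ (to (evenOrOdd n)) from
  where
  to : EvenOrOdd n → ⌊ n /2⌋ ≡ m → n ≡ m + m ⊎ n ≡ suc (m + m)
  to (even k) ⌊n/2⌋≡m = inj₁ (cong (λ x → x + x) (trans (n≡⌊n+n/2⌋ k) ⌊n/2⌋≡m))
  to (odd k)  ⌊n/2⌋≡m = inj₂ (cong (λ x → suc (x + x)) (trans (n≡⌊1+n+n/2⌋ k) ⌊n/2⌋≡m))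
  from : n ≡ m + m ⊎ n ≡ suc (m + m) → ⌊ n /2⌋ ≡ m
  from (inj₁ refl) = sym (n≡⌊n+n/2⌋ _)
  from (inj₂ refl) = sym (n≡⌊1+n+n/2⌋ _)

2∣n⇔parity≡0ℙ : ∀ n → 2 ∣ n ⇔ parity n ≡ 0ℙ
2∣n⇔parity≡0ℙ n = mk⇔ to (from n)
  where
  to : 2 ∣ n → parity n ≡ 0ℙ
  to (divides q refl) = trans (ℙₚ.*-homo-* q 2) (ℙₚ.*-zeroʳ (parity q))
  from : ∀ n → parity n ≡ 0ℙ → 2 ∣ n
  from zero          _   = divides 0 refl
  from (suc zero)    ()
  from (suc (suc n)) par = ∣m∣n⇒∣m+n ∣-refl (from n par)

a+a≡1+b⇒a≤b : a + a ≡ suc b → a ≤ b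
a+a≡1+b⇒a≤b {suc a} a+a≡1+b = subst (suc a ≤_) (suc-injective a+a≡1+b) (m≤n+m (suc a) a)

2*a≡b+1⇔1+b≡a+a : ∀ a b → 2 * a ≡ b + 1 ⇔ suc b ≡ a + a
2*a≡b+1⇔1+b≡a+a a b = mk⇔
  (λ eq → trans (+-comm 1 b) (trans (sym eq) 2*a≡a+a))
  (λ eq → trans 2*a≡a+a (trans (sym eq) (+-comm 1 b)))
  where 2*a≡a+a = cong (a +_) (+-identityʳ a)

4*[1+z]≡2+[z+1+z]+[z+1+z] : ∀ z → 4 * suc z ≡ 2 + ((z + suc z) + (z + suc z))
4*[1+z]≡2+[z+1+z]+[z+1+z] = solve-∀

suc⌊n/2⌋≡z+z⇔ : ∀ n z → .{{NonZero z}} → (suc ⌊ n /2⌋ ≡ z + z) ⇔ (n ≡ 4 * z ∸ 2 ⊎ n ≡ 4 * z ∸ 1)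
suc⌊n/2⌋≡z+z⇔ n (suc z) = begin
  suc ⌊ n /2⌋ ≡ suc z + suc z                ∼⟨ mk⇔ suc-injective (cong suc) ⟩
  ⌊ n /2⌋ ≡ w                                ∼⟨ ⌊n/2⌋≡m⇔ n w ⟩
  (n ≡ w + w ⊎ n ≡ suc (w + w))              ≡⟨ cong (λ x → n ≡ x ∸ 2 ⊎ n ≡ x ∸ 1)
                                                     (4*[1+z]≡2+[z+1+z]+[z+1+z] z) ⟨
  (n ≡ 4 * suc z ∸ 2 ⊎ n ≡ 4 * suc z ∸ 1)    ∎
  where
  w = z + suc z
  open EquationalReasoning

-- χ y ≡ 1ℙ iff y > 0 has even 2-adic valuation: for y = 1 + m, an odd y gives 1ℙ and an
-- even y gives χ (y / 2) ⁻¹. The fuel k only has to exceed y.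
χ-fuel : ℕ → ℕ → Parity
χ-fuel zero    _       = 0ℙ
χ-fuel (suc k) zero    = 0ℙ
χ-fuel (suc k) (suc m) = (parity m ℙ.* χ-fuel k (suc ⌊ m /2⌋)) ⁻¹

χ : ℕ → Parity
χ y = χ-fuel (suc y) y

χ-fuel-stable : ∀ k l y → y < k → y < l → χ-fuel k y ≡ χ-fuel l y
χ-fuel-stable (suc k) (suc l) zero          _         _         = refl
χ-fuel-stable (suc k) (suc l) (suc zero)    _         _         = refl
χ-fuel-stable (suc k) (suc l) (suc (suc m)) (s≤s y<k) (s≤s y<l) =
  cong (λ x → (parity (suc m) ℙ.* x) ⁻¹)
       (χ-fuel-stable k l _ (≤-trans (s≤s (⌊n/2⌋<n m)) y<k) (≤-trans (s≤s (⌊n/2⌋<n m)) y<l))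

χ-unfold : ∀ m → χ (suc m) ≡ (parity m ℙ.* χ (suc ⌊ m /2⌋)) ⁻¹
χ-unfold zero    = refl
χ-unfold (suc m) = cong (λ x → (parity (suc m) ℙ.* x) ⁻¹)
  (χ-fuel-stable (suc (suc m)) (suc (suc ⌊ suc m /2⌋)) _ (s≤s (⌊n/2⌋<n m)) ≤-refl)

χ[1+k+k]≡1ℙ : ∀ k → χ (suc (k + k)) ≡ 1ℙ
χ[1+k+k]≡1ℙ k = trans (χ-unfold (k + k)) (cong (λ p → (p ℙ.* χ (suc ⌊ k + k /2⌋)) ⁻¹) (parity[n+n]≡0ℙ k))

χ[2+k+k]≡χ[1+k]⁻¹ : ∀ k → χ (2 + (k + k)) ≡ χ (suc k) ⁻¹
χ[2+k+k]≡χ[1+k]⁻¹ k = begin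
  χ (2 + (k + k))                                          ≡⟨ χ-unfold (suc (k + k)) ⟩
  (parity (suc (k + k)) ℙ.* χ (suc ⌊ suc (k + k) /2⌋)) ⁻¹ ≡⟨ cong₂ (λ p x → (p ℙ.* χ (suc x)) ⁻¹)
                                                                (parity[1+n+n]≡1ℙ k) (sym (n≡⌊1+n+n/2⌋ k)) ⟩
  χ (suc k) ⁻¹                                             ∎
  where open ≡-Reasoning

χ[1+m]≡0ℙ⇔ : ∀ m → χ (suc m) ≡ 0ℙ ⇔ (∃[ z ] (suc m ≡ z + z × χ z ≡ 1ℙ))
χ[1+m]≡0ℙ⇔ m = mk⇔ (to (evenOrOdd m)) from
  where
  to : EvenOrOdd m → χ (suc m) ≡ 0ℙ → ∃[ z ] (suc m ≡ z + z × χ z ≡ 1ℙ)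
  to (even k) χ≡0ℙ = contradiction (trans (sym (χ[1+k+k]≡1ℙ k)) χ≡0ℙ) (ℙₚ.p≢p⁻¹ 1ℙ)
  to (odd k)  χ≡0ℙ = suc k , cong suc (sym (+-suc k k)) ,
                     sym (ℙₚ.⁻¹-selfInverse (trans (sym (χ[2+k+k]≡χ[1+k]⁻¹ k)) χ≡0ℙ))
  from : ∃[ z ] (suc m ≡ z + z × χ z ≡ 1ℙ) → χ (suc m) ≡ 0ℙ
  from (suc k , 1+m≡ , χ[1+k]≡1ℙ) = begin
    χ (suc m)         ≡⟨ cong χ (trans 1+m≡ (cong suc (+-suc k k))) ⟩
    χ (2 + (k + k))   ≡⟨ χ[2+k+k]≡χ[1+k]⁻¹ k ⟩
    χ (suc k) ⁻¹      ≡⟨ cong _⁻¹ χ[1+k]≡1ℙ ⟩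
    0ℙ                ∎
    where open ≡-Reasoning

χ≡0ℙ⇒χ[1+y]≡1ℙ : ∀ y → χ y ≡ 0ℙ → χ (suc y) ≡ 1ℙ
χ≡0ℙ⇒χ[1+y]≡1ℙ zero    _   = refl
χ≡0ℙ⇒χ[1+y]≡1ℙ (suc m) χ≡0ℙ with Equivalence.to (χ[1+m]≡0ℙ⇔ m) χ≡0ℙ
... | z , 1+m≡z+z , _ = trans (cong (χ ∘ suc) 1+m≡z+z) (χ[1+k+k]≡1ℙ z)

χ≡1ℙ⇒NonZero : χ n ≡ 1ℙ → NonZero n
χ≡1ℙ⇒NonZero {suc n} _ = _

χ[2+k]≡χ[1+k]+χ[1+⌊k/2⌋] : ∀ k → χ (2 + k) ≡ χ (1 + k) ℙ.+ χ (1 + ⌊ k /2⌋)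
χ[2+k]≡χ[1+k]+χ[1+⌊k/2⌋] k with evenOrOdd k
... | even j = begin
  χ (2 + (j + j))                         ≡⟨ χ[2+k+k]≡χ[1+k]⁻¹ j ⟩
  1ℙ ℙ.+ χ (suc j)                        ≡⟨ cong₂ (λ p x → p ℙ.+ χ (suc x))
                                                   (χ[1+k+k]≡1ℙ j) (sym (n≡⌊n+n/2⌋ j)) ⟨
  χ (suc (j + j)) ℙ.+ χ (suc ⌊ j + j /2⌋) ∎
  where open ≡-Reasoning
... | odd j = begin
  χ (3 + (j + j))                                 ≡⟨ cong (χ ∘ suc ∘ suc) (+-suc j j) ⟨
  χ (suc (suc j + suc j))                         ≡⟨ χ[1+k+k]≡1ℙ (suc j) ⟩
  1ℙ                                              ≡⟨ ℙₚ.p⁻¹+p≡1ℙ (χ (suc j)) ⟨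
  χ (suc j) ⁻¹ ℙ.+ χ (suc j)                      ≡⟨ cong₂ (λ p x → p ℙ.+ χ (suc x))
                                                           (χ[2+k+k]≡χ[1+k]⁻¹ j) (sym (n≡⌊1+n+n/2⌋ j)) ⟨
  χ (2 + (j + j)) ℙ.+ χ (suc ⌊ suc (j + j) /2⌋)   ∎
  where open ≡-Reasoning

HexTree-parity≡χ : ∀ n → HasParity (HexTree n) (χ (suc ⌊ n /2⌋))
HexTree-parity≡χ = HexTree-parity (χ ∘ suc ∘ ⌊_/2⌋) refl refl rec
  where
  rec : ∀ n → χ (2 + ⌊ n /2⌋) ≡ χ (suc ⌊ suc n /2⌋) ℙ.+ (parity n ⁻¹ ℙ.* χ (suc ⌊ ⌊ n /2⌋ /2⌋))
  rec n with evenOrOdd n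
  ... | even k rewrite sym (n≡⌊n+n/2⌋ k) | sym (n≡⌊1+n+n/2⌋ k) | parity[n+n]≡0ℙ k =
    χ[2+k]≡χ[1+k]+χ[1+⌊k/2⌋] k
  ... | odd k  rewrite sym (n≡⌊1+n+n/2⌋ k) | sym (n≡⌊n+n/2⌋ k) | parity[1+n+n]≡1ℙ k =
    sym (ℙₚ.+-identityʳ _)

Increasing : (ℕ → ℕ) → Set
Increasing f = ∀ n → f n < f (suc n)

module _ {f : ℕ → ℕ} (f↑ : Increasing f) where

  Increasing⇒<-mono : a < b → f a < f b
  Increasing⇒<-mono {a} {suc b} a<1+b with m≤n⇒m<n∨m≡n (≤-pred a<1+b)
  ... | inj₁ a<b  = <-trans (Increasing⇒<-mono a<b) (f↑ b)
  ... | inj₂ refl = f↑ b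

  Increasing⇒≤-cancel : f a ≤ f b → a ≤ b
  Increasing⇒≤-cancel {a} {b} fa≤fb with a ≤? b
  ... | yes a≤b = a≤b
  ... | no  a≰b = contradiction fa≤fb (<⇒≱ (Increasing⇒<-mono (≰⇒> a≰b)))

  Increasing⇒≥id : ∀ n → n ≤ f n
  Increasing⇒≥id zero    = z≤n
  Increasing⇒≥id (suc n) = ≤-trans (s≤s (Increasing⇒≥id n)) (f↑ n)

module TermsOfC (c : ℕ → ℕ) (c-spec : IsCSeq c) where

  private
    c-start : c 0 ≡ 1
    c-start = proj₁ c-spec
    c-step₁ : ∀ n → ¬ HalfIsTerm c n → c (suc n) ≡ c n + 1
    c-step₁ = proj₁ (proj₂ c-spec)
    c-step₂ : ∀ n → HalfIsTerm c n → c (suc n) ≡ c n + 2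
    c-step₂ = proj₂ (proj₂ c-spec)

  -- HalfIsTerm c n is not known to be decidable, but c n < c (1 + n) is, so a case split
  -- under double negation suffices.
  c-increasing : Increasing c
  c-increasing n = decidable-stable (c n <? c (suc n)) λ c≮ →
    c≮ (step-< (c-step₁ n (λ half → c≮ (step-< (c-step₂ n half)))))
    where
    step-< : ∀ {k} → c (suc n) ≡ c n + suc k → c n < c (suc n)
    step-< eq = subst (c n <_) (sym eq) (m<m+n (c n) (s≤s z≤n))

  EnumeratesUpTo : ℕ → Set
  EnumeratesUpTo n = (∀ j → j ≤ n → χ (c j) ≡ 1ℙ) × (∀ y → y ≤ c n → χ y ≡ 1ℙ → ∃[ k ] c k ≡ y)

  enumerates-0 : EnumeratesUpTo 0
  enumerates-0 = (λ { zero _ → cong χ c-start }) , complete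
    where
    complete : ∀ y → y ≤ c 0 → χ y ≡ 1ℙ → ∃[ k ] c k ≡ y
    complete (suc zero)    _    _ = 0 , c-start
    complete (suc (suc y)) y≤c₀ _ with s≤s () ← subst (suc (suc y) ≤_) c-start y≤c₀

  halfIsTerm⇔ : EnumeratesUpTo n → HalfIsTerm c n ⇔ χ (suc (c n)) ≡ 0ℙ
  halfIsTerm⇔ {n} (members , complete) = mk⇔ to from
    where
    to : HalfIsTerm c n → χ (suc (c n)) ≡ 0ℙ
    to (j , 2cⱼ≡cₙ+1) = Equivalence.from (χ[1+m]≡0ℙ⇔ (c n)) (c j , 1+cₙ≡cⱼ+cⱼ , members j j≤n)
      where
      1+cₙ≡cⱼ+cⱼ = Equivalence.to (2*a≡b+1⇔1+b≡a+a (c j) (c n)) 2cⱼ≡cₙ+1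
      j≤n = Increasing⇒≤-cancel c-increasing (a+a≡1+b⇒a≤b (sym 1+cₙ≡cⱼ+cⱼ))
    from : χ (suc (c n)) ≡ 0ℙ → HalfIsTerm c n
    from χ≡0ℙ with Equivalence.to (χ[1+m]≡0ℙ⇔ (c n)) χ≡0ℙ
    ... | z , 1+cₙ≡z+z , χz≡1ℙ with complete z (a+a≡1+b⇒a≤b (sym 1+cₙ≡z+z)) χz≡1ℙ
    ...   | k , refl = k , Equivalence.from (2*a≡b+1⇔1+b≡a+a (c k) (c n)) 1+cₙ≡z+z

  enumerates-extend : EnumeratesUpTo n → χ (c (suc n)) ≡ 1ℙ →
                      (∀ y → c n < y → y < c (suc n) → χ y ≡ 0ℙ) → EnumeratesUpTo (suc n)
  enumerates-extend {n} (members , complete) χ-next gap = members′ , complete′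
    where
    members′ : ∀ j → j ≤ suc n → χ (c j) ≡ 1ℙ
    members′ j j≤1+n with m≤n⇒m<n∨m≡n j≤1+n
    ... | inj₁ j<1+n = members j (≤-pred j<1+n)
    ... | inj₂ refl  = χ-next
    complete′ : ∀ y → y ≤ c (suc n) → χ y ≡ 1ℙ → ∃[ k ] c k ≡ y
    complete′ y y≤ χy≡1ℙ with y ≤? c n | m≤n⇒m<n∨m≡n y≤
    ... | yes y≤cₙ | _         = complete y y≤cₙ χy≡1ℙ
    ... | no  y≰cₙ | inj₁ y<   =
      contradiction (trans (sym χy≡1ℙ) (gap y (≰⇒> y≰cₙ) y<)) (ℙₚ.p≢p⁻¹ 1ℙ)
    ... | no  _    | inj₂ refl = suc n , refl

  enumerates-suc : EnumeratesUpTo n → EnumeratesUpTo (suc n)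
  enumerates-suc {n} e with χ (suc (c n)) in χ[1+cₙ]
  ... | 1ℙ = enumerates-extend e (trans (cong χ c-next) χ[1+cₙ])
                 (λ y cₙ<y y< → contradiction (≤-pred (subst (y <_) c-next y<)) (<⇒≱ cₙ<y))
    where
    not-half : ¬ HalfIsTerm c n
    not-half half = ℙₚ.p≢p⁻¹ 0ℙ (trans (sym (Equivalence.to (halfIsTerm⇔ e) half)) χ[1+cₙ])
    c-next : c (suc n) ≡ suc (c n)
    c-next = trans (c-step₁ n not-half) (+-comm (c n) 1)
  ... | 0ℙ = enumerates-extend e (trans (cong χ c-next) (χ≡0ℙ⇒χ[1+y]≡1ℙ (suc (c n)) χ[1+cₙ])) gap
    where
    c-next : c (suc n) ≡ suc (suc (c n))
    c-next = trans (c-step₂ n (Equivalence.from (halfIsTerm⇔ e) χ[1+cₙ])) (+-comm (c n) 2)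
    gap : ∀ y → c n < y → y < c (suc n) → χ y ≡ 0ℙ
    gap y cₙ<y y< with m≤n⇒m<n∨m≡n (≤-pred (subst (y <_) c-next y<))
    ... | inj₁ y<1+cₙ = contradiction (≤-pred y<1+cₙ) (<⇒≱ cₙ<y)
    ... | inj₂ refl   = χ[1+cₙ]

  enumerates : ∀ n → EnumeratesUpTo n
  enumerates zero    = enumerates-0
  enumerates (suc n) = enumerates-suc (enumerates n)

  term⇔χ≡1ℙ : ∀ y → (∃[ k ] c k ≡ y) ⇔ χ y ≡ 1ℙ
  term⇔χ≡1ℙ y = mk⇔
    (λ { (k , refl) → proj₁ (enumerates k) k ≤-refl })
    (proj₂ (enumerates y) y (Increasing⇒≥id c-increasing y))

  χ[1+m]≡0ℙ⇔twice-term : ∀ m → χ (suc m) ≡ 0ℙ ⇔ (∃[ k ] suc m ≡ c k + c k)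
  χ[1+m]≡0ℙ⇔twice-term m = mk⇔
    (λ χ≡0ℙ → let z , 1+m≡z+z , χz≡1ℙ = Equivalence.to (χ[1+m]≡0ℙ⇔ m) χ≡0ℙ
                  k , cₖ≡z = Equivalence.from (term⇔χ≡1ℙ z) χz≡1ℙ
              in k , trans 1+m≡z+z (cong (λ x → x + x) (sym cₖ≡z)))
    (λ (k , 1+m≡) → Equivalence.from (χ[1+m]≡0ℙ⇔ m)
                      (c k , 1+m≡ , Equivalence.to (term⇔χ≡1ℙ (c k)) (k , refl)))

  c-nonZero : ∀ k → NonZero (c k)
  c-nonZero k = χ≡1ℙ⇒NonZero (Equivalence.to (term⇔χ≡1ℙ (c k)) (k , refl))

corollary3p4 : (c : ℕ → ℕ) → IsCSeq c →
    (n H : ℕ) → HexTree n ↔ Fin H →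
    (2 ∣ H) ⇔ (∃[ k ] (n ≡ 4 * c k ∸ 2 ⊎ n ≡ 4 * c k ∸ 1))
corollary3p4 c c-spec n H HexTree↔Fin = begin
  2 ∣ H                                        ∼⟨ 2∣n⇔parity≡0ℙ H ⟩
  parity H ≡ 0ℙ                                 ≡⟨ cong (_≡ 0ℙ) parity-H ⟩
  χ (suc ⌊ n /2⌋) ≡ 0ℙ                          ∼⟨ χ[1+m]≡0ℙ⇔twice-term ⌊ n /2⌋ ⟩
  (∃[ k ] suc ⌊ n /2⌋ ≡ c k + c k)              ∼⟨ Σ-congˡ (λ {k} → suc⌊n/2⌋≡z+z⇔ n (c k) {{c-nonZero k}}) ⟩
  (∃[ k ] (n ≡ 4 * c k ∸ 2 ⊎ n ≡ 4 * c k ∸ 1))  ∎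
  where
  open EquationalReasoning
  open TermsOfC c c-spec
  parity-H : parity H ≡ χ (suc ⌊ n /2⌋)
  parity-H = HasParity⇒parity HexTree↔Fin (HexTree-parity≡χ n)
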